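{- Let $G$ be a finite simple graph. The following assertions are equivalent: (i) $G$ is a König–Egerváry graph; (ii) there is a maximum independent set $S$ of $G$ that is critical, i.e., $\alpha_c(G)=\alpha(G)$; (iii) every maximum independent set of $G$ is critical.
   Context: A set of vertices is independent if no two of its vertices are adjacent; $\mathrm{Ind}(G)$ is the family of independent sets, $\alpha(G)$ the maximum size of an independent set, and a maximum independent set is an independent set of size $\alpha(G)$. $\mu(G)$ is the size of a maximum matching. $G$ is a König–Egerváry graph if $\alpha(G)+\mu(G)=|V(G)|$. For $S\subseteq V(G)$, $N(S)$ is the set of vertices adjacent to some vertex of $S$. The critical difference is $d(G)=\max\{|S|-|N(S)| : S\in\mathrm{Ind}(G)\}$; an independent set $A$ is critical if $|A|-|N(A)|=d(G)$; $\alpha_c(G)$ is the maximum cardinality of a critical independent set. -}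

module Defs where

open import Data.Nat using (ℕ; zero; suc; _+_; _≤_)
open import Data.Bool using (Bool; true; false; _∧_; _∨_)
open import Data.Fin using (Fin; zero; suc)
open import Data.Fin.Subset using (Subset; _∈_; ∣_∣)
open import Data.Vec using (tabulate; lookup)
open import Data.List using (List; length; concatMap; _∷_; [])
open import Data.List.Relation.Unary.All using (All)
open import Data.List.Relation.Unary.Unique.Propositional using (Unique)
open import Data.Product using (_×_; Σ; ∃; _,_)
open import Data.Integer using (ℤ; +_; _-_; _≤_)
open import Relation.Binary.PropositionalEquality using (_≡_)
open import Relation.Nullary using (¬_)

record Graph : Set where
  field
    n      : ℕ
    adj    : Fin n → Fin n → Bool
    sym    : ∀ u v → adj u v ≡ adj v u
    irrefl : ∀ v → adj v v ≡ false
open Graph public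

anyFin : ∀ {k} → (Fin k → Bool) → Bool
anyFin {zero}  f = false
anyFin {suc k} f = f zero ∨ anyFin (λ i → f (suc i))

module _ (G : Graph) where

  Adj : Fin (n G) → Fin (n G) → Set
  Adj u v = adj G u v ≡ true

  Independent : Subset (n G) → Set
  Independent S = ∀ u v → u ∈ S → v ∈ S → ¬ Adj u v

  N : Subset (n G) → Subset (n G)
  N S = tabulate λ v → anyFin λ u → lookup S u ∧ adj G u v

  MaxIndependent : Subset (n G) → Set
  MaxIndependent S = Independent S × (∀ T → Independent T → ∣ T ∣ Data.Nat.≤ ∣ S ∣)

  diff : Subset (n G) → ℤ
  diff S = + ∣ S ∣ - + ∣ N S ∣

  Critical : Subset (n G) → Set
  Critical A = Independent A × (∀ T → Independent T → diff T Data.Integer.≤ diff A)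

  endpoints : List (Fin (n G) × Fin (n G)) → List (Fin (n G))
  endpoints = concatMap λ { (u , v) → u ∷ v ∷ [] }

  Matching : List (Fin (n G) × Fin (n G)) → Set
  Matching M = All (λ { (u , v) → Adj u v }) M × Unique (endpoints M)

  MaxMatching : List (Fin (n G) × Fin (n G)) → Set
  MaxMatching M = Matching M × (∀ M' → Matching M' → length M' Data.Nat.≤ length M)

  KönigEgerváry : Set
  KönigEgerváry = Σ (Subset (n G)) λ S → Σ (List (Fin (n G) × Fin (n G))) λ M →
    MaxIndependent S × MaxMatching M × ∣ S ∣ + length M ≡ n G

-- If a maximum independent set S is critical, every Z ⊆ ∁S has at least |Z| neighbours in S: otherwise
-- A = S ─ N(Z) would have |A| − |N(A)| > |S| − |N(S)|.  Hall's theorem then matches ∁S into S, so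
-- μ ≥ n − α, while |S| + μ ≤ n for every independent S; hence α + μ = n.
-- Conversely, let T be independent.  Every edge uv of a matching contributes at least 2 to
-- [u ∉ T] + [v ∉ T] + [u ∈ N(T)] + [v ∈ N(T)], because an endpoint in T puts the other one both outside T
-- and into N(T); summing over a matching gives 2μ ≤ (n − |T|) + |N(T)|.  Together with |S| + |N(S)| ≤ n
-- and α + μ = n this is |T| − |N(T)| ≤ |S| − |N(S)| for every maximum independent set S.
module Submission where

open import Data.Bool as Bool using (Bool; true; false; _∧_; not; if_then_else_)
open import Data.Bool.Properties using (∧-conicalˡ; ∧-conicalʳ)
open import Data.Empty using (⊥-elim)
open import Data.Fin using (Fin)
open import Data.Fin.Properties using (all?)
open import Data.Fin.Subset
open import Data.Fin.Subset.Properties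
import Data.Integer as ℤ
import Data.Integer.Properties as ℤ
import Data.Integer.Tactic.RingSolver as ℤ
open import Data.List as List using (List; []; _∷_; length; filter; allFin)
open import Data.List.Properties using (length-map)
open import Data.List.Membership.Propositional using () renaming (_∈_ to _∈ₗ_)
open import Data.List.Membership.Propositional.Properties using (∈-filter⁺; ∈-allFin)
open import Data.List.Relation.Unary.All as All using (All; []; _∷_)
open import Data.List.Relation.Unary.All.Properties using (all-filter)
open import Data.List.Relation.Unary.AllPairs using ([]; _∷_)
open import Data.List.Relation.Unary.Any using (here; there)
open import Data.List.Relation.Unary.Unique.Propositional using (Unique)
open import Data.List.Relation.Unary.Unique.Propositional.Properties using (filter⁺; allFin⁺)
open import Data.Nat using (ℕ; zero; suc; _+_; _*_; _≤_; _<_; z≤n; s≤s)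
open import Data.Nat.Properties
open import Data.Nat.Tactic.RingSolver using (solve-∀)
open import Data.Product using (_×_; ∃; _,_; proj₁; proj₂)
open import Data.Sum using (inj₁; inj₂)
open import Data.Vec using ([]; _∷_; here; there; lookup; tabulate)
open import Data.Vec.Properties using (lookup∘tabulate; []=⇒lookup; lookup⇒[]=)
open import Function using (_∘_; case_of_)
open import Function.Bundles using (_⇔_; mk⇔; Equivalence)
open import Relation.Binary.PropositionalEquality
open import Relation.Nullary using (¬_; Dec; yes; no; does; contradiction)
open import Relation.Nullary.Decidable using (_×-dec_; _→-dec_; ¬?)
open import Relation.Unary using (Decidable)

open import Defs hiding (sym)

private variable
  a b m : ℕ
  x y : Fin m
  p q : Subset m

+m-+n≤+o-+p⇔m+p≤o+n : ∀ m n o p → ℤ.+ m ℤ.- ℤ.+ n ℤ.≤ ℤ.+ o ℤ.- ℤ.+ p ⇔ m + p ≤ o + n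
+m-+n≤+o-+p⇔m+p≤o+n m n o p = mk⇔
  (λ h → ℤ.drop‿+≤+ (subst₂ ℤ._≤_
     (trans (lhs→ (ℤ.+ m) (ℤ.+ n) (ℤ.+ p)) (sym (ℤ.pos-+ m p)))
     (trans (rhs→ (ℤ.+ o) (ℤ.+ n) (ℤ.+ p)) (sym (ℤ.pos-+ o n)))
     (ℤ.+-monoˡ-≤ (ℤ.+ n ℤ.+ ℤ.+ p) h)))
  (λ h → subst₂ ℤ._≤_
     (trans (cong (ℤ._- (ℤ.+ n ℤ.+ ℤ.+ p)) (ℤ.pos-+ m p)) (lhs← (ℤ.+ m) (ℤ.+ n) (ℤ.+ p)))
     (trans (cong (ℤ._- (ℤ.+ n ℤ.+ ℤ.+ p)) (ℤ.pos-+ o n)) (rhs← (ℤ.+ o) (ℤ.+ n) (ℤ.+ p)))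
     (ℤ.+-monoˡ-≤ (ℤ.- (ℤ.+ n ℤ.+ ℤ.+ p)) (ℤ.+≤+ h)))
  where
  lhs→ : ∀ i j k → (i ℤ.- j) ℤ.+ (j ℤ.+ k) ≡ i ℤ.+ k
  lhs→ = ℤ.solve-∀
  rhs→ : ∀ i j k → (i ℤ.- k) ℤ.+ (j ℤ.+ k) ≡ i ℤ.+ j
  rhs→ = ℤ.solve-∀
  lhs← : ∀ i j k → (i ℤ.+ k) ℤ.- (j ℤ.+ k) ≡ i ℤ.- j
  lhs← = ℤ.solve-∀
  rhs← : ∀ i j k → (i ℤ.+ j) ℤ.- (j ℤ.+ k) ≡ i ℤ.- k
  rhs← = ℤ.solve-∀

-- Cardinalities of finite subsets

x∈p─q⇒x∉q : x ∈ p ─ q → x ∉ q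
x∈p─q⇒x∉q {p = _ ∷ _} {q = inside ∷ _} () here
x∈p─q⇒x∉q {p = _ ∷ _} {q = _ ∷ _} (there x∈p─q) (there x∈q) = x∈p─q⇒x∉q x∈p─q x∈q

∣p∪q∣≤∣p∣+∣q∣ : ∀ (p q : Subset m) → ∣ p ∪ q ∣ ≤ ∣ p ∣ + ∣ q ∣
∣p∪q∣≤∣p∣+∣q∣ []            []            = z≤n
∣p∪q∣≤∣p∣+∣q∣ (inside  ∷ p) (inside  ∷ q) = s≤s (≤-trans (∣p∪q∣≤∣p∣+∣q∣ p q) (+-monoʳ-≤ ∣ p ∣ (n≤1+n ∣ q ∣)))
∣p∪q∣≤∣p∣+∣q∣ (inside  ∷ p) (outside ∷ q) = s≤s (∣p∪q∣≤∣p∣+∣q∣ p q)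
∣p∪q∣≤∣p∣+∣q∣ (outside ∷ p) (inside  ∷ q) = subst (suc ∣ p ∪ q ∣ ≤_) (sym (+-suc ∣ p ∣ ∣ q ∣)) (s≤s (∣p∪q∣≤∣p∣+∣q∣ p q))
∣p∪q∣≤∣p∣+∣q∣ (outside ∷ p) (outside ∷ q) = ∣p∪q∣≤∣p∣+∣q∣ p q

∣p∪q∣≡∣p∣+∣q∣ : ∀ (p q : Subset m) → (∀ {x} → x ∈ p → x ∉ q) → ∣ p ∪ q ∣ ≡ ∣ p ∣ + ∣ q ∣
∣p∪q∣≡∣p∣+∣q∣ []            []            _ = refl
∣p∪q∣≡∣p∣+∣q∣ (inside  ∷ p) (inside  ∷ q) disjoint = contradiction here (disjoint here)
∣p∪q∣≡∣p∣+∣q∣ (inside  ∷ p) (outside ∷ q) disjoint = cong suc (∣p∪q∣≡∣p∣+∣q∣ p q (λ x∈p → disjoint (there x∈p) ∘ there))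
∣p∪q∣≡∣p∣+∣q∣ (outside ∷ p) (inside  ∷ q) disjoint = trans (cong suc (∣p∪q∣≡∣p∣+∣q∣ p q (λ x∈p → disjoint (there x∈p) ∘ there))) (sym (+-suc ∣ p ∣ ∣ q ∣))
∣p∪q∣≡∣p∣+∣q∣ (outside ∷ p) (outside ∷ q) disjoint = ∣p∪q∣≡∣p∣+∣q∣ p q (λ x∈p → disjoint (there x∈p) ∘ there)

∣p∣+∣∁p∣≡n : ∀ (p : Subset m) → ∣ p ∣ + ∣ ∁ p ∣ ≡ m
∣p∣+∣∁p∣≡n {m} p = begin
  ∣ p ∣ + ∣ ∁ p ∣  ≡⟨ ∣p∪q∣≡∣p∣+∣q∣ p (∁ p) x∈p⇒x∉∁p ⟨
  ∣ p ∪ ∁ p ∣      ≡⟨ cong ∣_∣ (p∪∁p≡⊤ p) ⟩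
  ∣ ⊤ {m} ∣        ≡⟨ ∣⊤∣≡n m ⟩
  m                ∎
  where open ≡-Reasoning

x∈p⇒0<∣p∣ : x ∈ p → 0 < ∣ p ∣
x∈p⇒0<∣p∣ x∈p = ≤-<-trans z≤n (x∈p⇒∣p-x∣<∣p∣ x∈p)

Empty⇒∣p∣≡0 : Empty p → ∣ p ∣ ≡ 0
Empty⇒∣p∣≡0 {m} empty = trans (cong ∣_∣ (Empty-unique empty)) (∣⊥∣≡0 m)

0<∣p∣⇒Nonempty : 0 < ∣ p ∣ → Nonempty p
0<∣p∣⇒Nonempty {p = p} 0<∣p∣ with nonempty? p
... | yes nonempty = nonempty
... | no  empty    = contradiction (Empty⇒∣p∣≡0 empty) (>⇒≢ 0<∣p∣)

∣p∣≤1+∣p-x∣ : ∀ (p : Subset m) x → ∣ p ∣ ≤ suc ∣ p - x ∣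
∣p∣≤1+∣p-x∣ p x = begin
  ∣ p ∣                   ≤⟨ p⊆q⇒∣p∣≤∣q∣ p⊆[p-x]∪⁅x⁆ ⟩
  ∣ (p - x) ∪ ⁅ x ⁆ ∣     ≤⟨ ∣p∪q∣≤∣p∣+∣q∣ (p - x) ⁅ x ⁆ ⟩
  ∣ p - x ∣ + ∣ ⁅ x ⁆ ∣   ≡⟨ cong (∣ p - x ∣ +_) (∣⁅x⁆∣≡1 x) ⟩
  ∣ p - x ∣ + 1           ≡⟨ +-comm ∣ p - x ∣ 1 ⟩
  suc ∣ p - x ∣           ∎
  where
  open ≤-Reasoning
  p⊆[p-x]∪⁅x⁆ : p ⊆ (p - x) ∪ ⁅ x ⁆
  p⊆[p-x]∪⁅x⁆ {y} y∈p with y Data.Fin.≟ x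
  ... | yes refl = x∈p∪q⁺ (inj₂ (x∈⁅x⁆ x))
  ... | no  y≢x  = x∈p∪q⁺ (inj₁ (x∈p∧x≢y⇒x∈p-y y∈p y≢x))

unique-⊆⇒length≤∣p∣ : ∀ {L : List (Fin m)} → Unique L → All (_∈ p) L → length L ≤ ∣ p ∣
unique-⊆⇒length≤∣p∣ {L = []} _ _ = z≤n
unique-⊆⇒length≤∣p∣ {p = p} {L = x ∷ L} (x∉L ∷ L-unique) (x∈p ∷ L⊆p) =
  <-≤-trans (s≤s (unique-⊆⇒length≤∣p∣ L-unique (remove-x x∉L L⊆p))) (x∈p⇒∣p-x∣<∣p∣ x∈p)
  where
  remove-x : ∀ {L} → All (x ≢_) L → All (_∈ p) L → All (_∈ p - x) L
  remove-x []            []            = []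
  remove-x (x≢y ∷ x≢L) (y∈p ∷ L⊆p) = x∈p∧x≢y⇒x∈p-y y∈p (x≢y ∘ sym) ∷ remove-x x≢L L⊆p

⊆-list⇒∣p∣≤length : ∀ (L : List (Fin m)) → (∀ {x} → x ∈ p → x ∈ₗ L) → ∣ p ∣ ≤ length L
⊆-list⇒∣p∣≤length [] p⊆[] = ≤-reflexive (Empty⇒∣p∣≡0 λ (_ , x∈p) → case p⊆[] x∈p of λ ())
⊆-list⇒∣p∣≤length {p = p} (y ∷ L) p⊆y∷L =
  ≤-trans (∣p∣≤1+∣p-x∣ p y) (s≤s (⊆-list⇒∣p∣≤length L p-y⊆L))
  where
  p-y⊆L : ∀ {x} → x ∈ p - y → x ∈ₗ L
  p-y⊆L x∈p-y with p⊆y∷L (p─q⊆p p ⁅ y ⁆ x∈p-y)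
  ... | here refl = contradiction (x∈⁅x⁆ y) (x∈p─q⇒x∉q x∈p-y)
  ... | there x∈L = x∈L

length-filter-∈-allFin : ∀ (p : Subset m) → length (filter (_∈? p) (allFin m)) ≡ ∣ p ∣
length-filter-∈-allFin {m} p = ≤-antisym
  (unique-⊆⇒length≤∣p∣ (filter⁺ (_∈? p) (allFin⁺ m)) (all-filter (_∈? p) (allFin m)))
  (⊆-list⇒∣p∣≤length _ (λ x∈p → ∈-filter⁺ (_∈? p) (∈-allFin _) x∈p))

χ : Subset m → Fin m → ℕ
χ p x = if does (x ∈? p) then 1 else 0

χ-∈ : x ∈ p → χ p x ≡ 1
χ-∈ {x = x} {p = p} x∈p with x ∈? p
... | yes _   = refl
... | no  x∉p = contradiction x∈p x∉p

count : Subset m → List (Fin m) → ℕ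
count p L = length (filter (_∈? p) L)

count-∷ : ∀ (p : Subset m) x L → count p (x ∷ L) ≡ χ p x + count p L
count-∷ p x L with x ∈? p
... | yes _ = refl
... | no  _ = refl

count≤∣p∣ : ∀ (p : Subset m) {L} → Unique L → count p L ≤ ∣ p ∣
count≤∣p∣ p {L} L-unique = unique-⊆⇒length≤∣p∣ (filter⁺ (_∈? p) L-unique) (all-filter (_∈? p) L)

Maximum : (Subset m → Set) → Subset m → Set
Maximum P p = P p × (∀ q → P q → ∣ q ∣ ≤ ∣ p ∣)

module _ {P : Subset m → Set} (P? : Decidable P) where

  maximum-above : ∀ k {p} → P p → m ≤ k + ∣ p ∣ → ∃ (Maximum P)
  maximum-above k {p} Pp _ with anySubset? (λ q → P? q ×-dec ∣ p ∣ <? ∣ q ∣)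
  ... | no none = p , Pp , λ q Pq → ≮⇒≥ (λ ∣p∣<∣q∣ → none (q , Pq , ∣p∣<∣q∣))
  maximum-above zero    {p} _ m≤∣p∣ | yes (q , _ , ∣p∣<∣q∣) =
    contradiction (≤-trans (∣p∣≤n q) m≤∣p∣) (<⇒≱ ∣p∣<∣q∣)
  maximum-above (suc k) {p} _ m≤1+k+∣p∣ | yes (q , Pq , ∣p∣<∣q∣) =
    maximum-above k Pq (≤-trans m≤1+k+∣p∣ (subst (_≤ k + ∣ q ∣) (+-suc k ∣ p ∣) (+-monoʳ-≤ k ∣p∣<∣q∣)))

  maximum-exists : P p → ∃ (Maximum P)
  maximum-exists {p} Pp = maximum-above m Pp (m≤m+n m ∣ p ∣)

-- Neighbourhoods for a Boolean relation

anyFin-true⁺ : ∀ (f : Fin m → Bool) i → f i ≡ true → anyFin f ≡ true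
anyFin-true⁺ f Fin.zero    fi≡true rewrite fi≡true = refl
anyFin-true⁺ f (Fin.suc i) fi≡true with f Fin.zero
... | true  = refl
... | false = anyFin-true⁺ (f ∘ Fin.suc) i fi≡true

anyFin-true⁻ : ∀ (f : Fin m → Bool) → anyFin f ≡ true → ∃ λ i → f i ≡ true
anyFin-true⁻ {suc m} f any≡true with f Fin.zero in f0≡
... | true  = Fin.zero , f0≡
... | false with anyFin-true⁻ (f ∘ Fin.suc) any≡true
...   | i , fi≡true = Fin.suc i , fi≡true

∈⇒lookup : x ∈ p → lookup p x ≡ true
∈⇒lookup = []=⇒lookup

lookup⇒∈ : lookup p x ≡ true → x ∈ p
lookup⇒∈ {p = p} {x = x} = lookup⇒[]= x p

∉⇒not-lookup : ∀ {p : Subset m} {x} → x ∉ p → not (lookup p x) ≡ true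
∉⇒not-lookup {p = p} {x = x} x∉p with lookup p x in p[x]
... | true  = contradiction (lookup⇒∈ p[x]) x∉p
... | false = refl

not-lookup⇒∉ : not (lookup p x) ≡ true → x ∉ p
not-lookup⇒∉ not-p[x] x∈p rewrite ∈⇒lookup x∈p = case not-p[x] of λ ()

Nbr : (Fin a → Fin b → Bool) → Subset a → Subset b
Nbr R W = tabulate λ y → anyFin λ x → lookup W x ∧ R x y

∈-Nbr⁺ : ∀ (R : Fin a → Fin b → Bool) {W x y} → x ∈ W → R x y ≡ true → y ∈ Nbr R W
∈-Nbr⁺ R {W} {x} {y} x∈W Rxy = lookup⇒∈ (trans (lookup∘tabulate _ y)
  (anyFin-true⁺ (λ x → lookup W x ∧ R x y) x (cong₂ _∧_ (∈⇒lookup x∈W) Rxy)))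

∈-Nbr⁻ : ∀ (R : Fin a → Fin b → Bool) W {y} → y ∈ Nbr R W → ∃ λ x → x ∈ W × R x y ≡ true
∈-Nbr⁻ R W {y} y∈NW with anyFin-true⁻ _ (trans (sym (lookup∘tabulate _ y)) (∈⇒lookup y∈NW))
... | x , W[x]∧Rxy = x , lookup⇒∈ (∧-conicalˡ _ _ W[x]∧Rxy) , ∧-conicalʳ _ _ W[x]∧Rxy

_∖_ : (Fin a → Fin b → Bool) → Subset b → (Fin a → Fin b → Bool)
(R ∖ Y) x y = R x y ∧ not (lookup Y y)

∖-true⁺ : ∀ (R : Fin a → Fin b → Bool) {Y x y} → R x y ≡ true → y ∉ Y → (R ∖ Y) x y ≡ true
∖-true⁺ R Rxy y∉Y = cong₂ _∧_ Rxy (∉⇒not-lookup y∉Y)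

∖-true⁻ : ∀ (R : Fin a → Fin b → Bool) {Y x y} → (R ∖ Y) x y ≡ true → R x y ≡ true × y ∉ Y
∖-true⁻ R Rxy∧y∉Y = ∧-conicalˡ _ _ Rxy∧y∉Y , not-lookup⇒∉ (∧-conicalʳ _ _ Rxy∧y∉Y)

-- Hall's theorem

HallCondition : (Fin a → Fin b → Bool) → Subset a → Set
HallCondition R X = ∀ W → W ⊆ X → ∣ W ∣ ≤ ∣ Nbr R W ∣

-- partner is only defined on X, so an empty X needs no element of Fin b.
record SaturatingMatching (R : Fin a → Fin b → Bool) (X : Subset a) : Set where
  field
    partner   : ∀ {x} → x ∈ X → Fin b
    related   : ∀ {x} (x∈X : x ∈ X) → R x (partner x∈X) ≡ true
    injective : ∀ {x y} (x∈X : x ∈ X) (y∈X : y ∈ X) → partner x∈X ≡ partner y∈X → x ≡ y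
open SaturatingMatching

empty-saturating : ∀ {R : Fin a → Fin b → Bool} {X} → Empty X → SaturatingMatching R X
empty-saturating X-empty = record
  { partner   = λ x∈X → ⊥-elim (X-empty (_ , x∈X))
  ; related   = λ x∈X → ⊥-elim (X-empty (_ , x∈X))
  ; injective = λ x∈X _ _ → ⊥-elim (X-empty (_ , x∈X))
  }

singleton-saturating : ∀ {R : Fin a → Fin b → Bool} {x y} → R x y ≡ true → SaturatingMatching R ⁅ x ⁆
singleton-saturating {R = R} {x = x} {y = y} Rxy = record
  { partner   = λ _ → y
  ; related   = λ x'∈⁅x⁆ → subst (λ x' → R x' y ≡ true) (sym (x∈⁅y⁆⇒x≡y x x'∈⁅x⁆)) Rxy
  ; injective = λ x₁∈⁅x⁆ x₂∈⁅x⁆ _ → trans (x∈⁅y⁆⇒x≡y x x₁∈⁅x⁆) (sym (x∈⁅y⁆⇒x≡y x x₂∈⁅x⁆))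
  }

glue : ∀ {R : Fin a → Fin b → Bool} {X W Y} (m : SaturatingMatching R W) →
       (∀ {x} (x∈W : x ∈ W) → partner m x∈W ∈ Y) →
       SaturatingMatching (R ∖ Y) (X ─ W) → SaturatingMatching R X
glue {b = b} {R = R} {X = X} {W = W} {Y = Y} m m⊆Y m' = record { partner = f ; related = f-related ; injective = f-injective }
  where
  outside-W : ∀ {x} → x ∈ X → x ∉ W → x ∈ X ─ W
  outside-W = x∈p∧x∉q⇒x∈p─q

  f : ∀ {x} → x ∈ X → Fin b
  f {x} x∈X with x ∈? W
  ... | yes x∈W = partner m x∈W
  ... | no  x∉W = partner m' (outside-W x∈X x∉W)

  f-related : ∀ {x} (x∈X : x ∈ X) → R x (f x∈X) ≡ true
  f-related {x} x∈X with x ∈? W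
  ... | yes x∈W = related m x∈W
  ... | no  x∉W = proj₁ (∖-true⁻ R {Y} (related m' (outside-W x∈X x∉W)))

  f-injective : ∀ {x y} (x∈X : x ∈ X) (y∈X : y ∈ X) → f x∈X ≡ f y∈X → x ≡ y
  f-injective {x} {y} x∈X y∈X fx≡fy with x ∈? W | y ∈? W
  ... | yes x∈W | yes y∈W = injective m x∈W y∈W fx≡fy
  ... | no  x∉W | no  y∉W = injective m' (outside-W x∈X x∉W) (outside-W y∈X y∉W) fx≡fy
  ... | yes x∈W | no  y∉W =
    contradiction (subst (_∈ Y) fx≡fy (m⊆Y x∈W)) (proj₂ (∖-true⁻ R {Y} (related m' (outside-W y∈X y∉W))))
  ... | no  x∉W | yes y∈W =
    contradiction (subst (_∈ Y) (sym fx≡fy) (m⊆Y y∈W)) (proj₂ (∖-true⁻ R {Y} (related m' (outside-W x∈X x∉W))))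

Nbr⊆Nbr-avoiding∪ : ∀ (R : Fin a → Fin b → Bool) Y Z → Nbr R Z ⊆ Nbr (R ∖ Y) Z ∪ Y
Nbr⊆Nbr-avoiding∪ R Y Z {y} y∈NZ with ∈-Nbr⁻ R Z y∈NZ | y ∈? Y
... | _ , _   , _   | yes y∈Y = x∈p∪q⁺ (inj₂ y∈Y)
... | _ , x∈Z , Rxy | no  y∉Y = x∈p∪q⁺ (inj₁ (∈-Nbr⁺ (R ∖ Y) {y = y} x∈Z (∖-true⁺ R Rxy y∉Y)))

Nbr-avoiding-∪ : ∀ (R : Fin a → Fin b → Bool) {Y Z W} → Nbr R W ⊆ Y → Nbr (R ∖ Y) (Z ∪ W) ⊆ Nbr (R ∖ Y) Z
Nbr-avoiding-∪ R {Y} {Z} {W} NW⊆Y {y} y∈N[Z∪W] with ∈-Nbr⁻ (R ∖ Y) (Z ∪ W) y∈N[Z∪W]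
... | x , x∈Z∪W , R'xy with ∖-true⁻ R {Y} R'xy | x∈p∪q⁻ Z W x∈Z∪W
...   | _   , _   | inj₁ x∈Z = ∈-Nbr⁺ (R ∖ Y) {y = y} x∈Z R'xy
...   | Rxy , y∉Y | inj₂ x∈W = contradiction (NW⊆Y (∈-Nbr⁺ R x∈W Rxy)) y∉Y

∣Nbr∣≤∣Nbr-avoiding∣+∣Y∣ : ∀ (R : Fin a → Fin b → Bool) Y Z → ∣ Nbr R Z ∣ ≤ ∣ Nbr (R ∖ Y) Z ∣ + ∣ Y ∣
∣Nbr∣≤∣Nbr-avoiding∣+∣Y∣ R Y Z =
  ≤-trans (p⊆q⇒∣p∣≤∣q∣ (Nbr⊆Nbr-avoiding∪ R Y Z)) (∣p∪q∣≤∣p∣+∣q∣ (Nbr (R ∖ Y) Z) Y)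

Tight : (Fin a → Fin b → Bool) → Subset a → Subset a → Set
Tight R X W = Nonempty W × W ⊆ X × ∣ W ∣ < ∣ X ∣ × ∣ Nbr R W ∣ ≤ ∣ W ∣

tight? : ∀ (R : Fin a → Fin b → Bool) X W → Dec (Tight R X W)
tight? R X W = nonempty? W ×-dec W ⊆? X ×-dec ∣ W ∣ <? ∣ X ∣ ×-dec ∣ Nbr R W ∣ ≤? ∣ W ∣

hall⇒related : ∀ (R : Fin a → Fin b → Bool) {X x} → HallCondition R X → x ∈ X → ∃ λ y → R x y ≡ true
hall⇒related R {X} {x} X-hall x∈X with 0<∣p∣⇒Nonempty (subst (_≤ ∣ Nbr R ⁅ x ⁆ ∣) (∣⁅x⁆∣≡1 x) (X-hall ⁅ x ⁆ ⁅x⁆⊆X))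
  where
  ⁅x⁆⊆X : ⁅ x ⁆ ⊆ X
  ⁅x⁆⊆X x'∈⁅x⁆ = subst (_∈ X) (sym (x∈⁅y⁆⇒x≡y x x'∈⁅x⁆)) x∈X
... | y , y∈N⁅x⁆ with ∈-Nbr⁻ R ⁅ x ⁆ y∈N⁅x⁆
...   | x' , x'∈⁅x⁆ , Rx'y = y , subst (λ x' → R x' y ≡ true) (x∈⁅y⁆⇒x≡y x x'∈⁅x⁆) Rx'y

hall-outside-tight : ∀ (R : Fin a → Fin b → Bool) {X W} → HallCondition R X → W ⊆ X → ∣ Nbr R W ∣ ≤ ∣ W ∣ →
                    HallCondition (R ∖ Nbr R W) (X ─ W)
hall-outside-tight R {X} {W} X-hall W⊆X W-tight Z Z⊆X─W = +-cancelʳ-≤ (∣ W ∣) (∣ Z ∣) (∣ Nbr R' Z ∣) (begin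
  ∣ Z ∣ + ∣ W ∣                    ≡⟨ ∣p∪q∣≡∣p∣+∣q∣ Z W (x∈p─q⇒x∉q ∘ Z⊆X─W) ⟨
  ∣ Z ∪ W ∣                        ≤⟨ X-hall (Z ∪ W) Z∪W⊆X ⟩
  ∣ Nbr R (Z ∪ W) ∣                ≤⟨ ∣Nbr∣≤∣Nbr-avoiding∣+∣Y∣ R (Nbr R W) (Z ∪ W) ⟩
  ∣ Nbr R' (Z ∪ W) ∣ + ∣ Nbr R W ∣ ≤⟨ +-mono-≤ (p⊆q⇒∣p∣≤∣q∣ (Nbr-avoiding-∪ R {Z = Z} {W} (λ y∈NW → y∈NW))) W-tight ⟩
  ∣ Nbr R' Z ∣ + ∣ W ∣             ∎)
  where
  open ≤-Reasoning
  R' = R ∖ Nbr R W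
  Z∪W⊆X : Z ∪ W ⊆ X
  Z∪W⊆X x∈Z∪W with x∈p∪q⁻ Z W x∈Z∪W
  ... | inj₁ x∈Z = p─q⊆p X W (Z⊆X─W x∈Z)
  ... | inj₂ x∈W = W⊆X x∈W

hall-outside-point : ∀ (R : Fin a → Fin b → Bool) {X x₀} y₀ → x₀ ∈ X → ¬ ∃ (Tight R X) →
                    HallCondition (R ∖ ⁅ y₀ ⁆) (X - x₀)
hall-outside-point R {X} {x₀} y₀ x₀∈X no-tight Z Z⊆X-x₀ with nonempty? Z
... | no  Z-empty = ≤-trans (≤-reflexive (Empty⇒∣p∣≡0 Z-empty)) z≤n
... | yes Z-nonempty = ≤-pred (begin
  suc ∣ Z ∣                        ≤⟨ ≰⇒> (λ Z-tight → no-tight (Z , Z-nonempty , Z⊆X , ∣Z∣<∣X∣ , Z-tight)) ⟩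
  ∣ Nbr R Z ∣                      ≤⟨ ∣Nbr∣≤∣Nbr-avoiding∣+∣Y∣ R ⁅ y₀ ⁆ Z ⟩
  ∣ Nbr R' Z ∣ + ∣ ⁅ y₀ ⁆ ∣        ≡⟨ cong (∣ Nbr R' Z ∣ +_) (∣⁅x⁆∣≡1 y₀) ⟩
  ∣ Nbr R' Z ∣ + 1                 ≡⟨ +-comm ∣ Nbr R' Z ∣ 1 ⟩
  suc ∣ Nbr R' Z ∣                 ∎)
  where
  open ≤-Reasoning
  R' = R ∖ ⁅ y₀ ⁆
  Z⊆X : Z ⊆ X
  Z⊆X = p─q⊆p X ⁅ x₀ ⁆ ∘ Z⊆X-x₀
  ∣Z∣<∣X∣ : ∣ Z ∣ < ∣ X ∣
  ∣Z∣<∣X∣ = ≤-<-trans (p⊆q⇒∣p∣≤∣q∣ Z⊆X-x₀) (x∈p⇒∣p-x∣<∣p∣ x₀∈X)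

-- Halmos–Vaughan: split X at a tight set if there is one, otherwise match some x₀ ∈ X to any neighbour y₀
-- and continue without both.
hall-bounded : ∀ k {R : Fin a → Fin b → Bool} {X} → ∣ X ∣ ≤ k → HallCondition R X → SaturatingMatching R X
hall-bounded k {R} {X} _ _ with nonempty? X
... | no X-empty = empty-saturating X-empty
hall-bounded zero {R} {X} ∣X∣≤0 _ | yes (_ , x∈X) = contradiction ∣X∣≤0 (<⇒≱ (x∈p⇒0<∣p∣ x∈X))
hall-bounded (suc k) {R} {X} ∣X∣≤1+k X-hall | yes (x₀ , x₀∈X) with anySubset? (tight? R X)
... | yes (W , (w , w∈W) , W⊆X , ∣W∣<∣X∣ , W-tight) =
  glue {X = X} on-W (λ x∈W → ∈-Nbr⁺ R x∈W (related on-W x∈W)) on-X─W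
  where
  on-W : SaturatingMatching R W
  on-W = hall-bounded k (≤-pred (≤-trans ∣W∣<∣X∣ ∣X∣≤1+k)) (λ V V⊆W → X-hall V (W⊆X ∘ V⊆W))
  on-X─W : SaturatingMatching (R ∖ Nbr R W) (X ─ W)
  on-X─W = hall-bounded k (≤-pred (≤-trans (p∩q≢∅⇒∣p─q∣<∣p∣ X W (w , x∈p∩q⁺ (W⊆X w∈W , w∈W))) ∣X∣≤1+k))
                        (hall-outside-tight R X-hall W⊆X W-tight)
... | no no-tight with hall⇒related R X-hall x₀∈X
...   | y₀ , Rx₀y₀ =
  glue {X = X} (singleton-saturating Rx₀y₀) (λ _ → x∈⁅x⁆ y₀)
       (hall-bounded k (≤-pred (≤-trans (x∈p⇒∣p-x∣<∣p∣ x₀∈X) ∣X∣≤1+k)) (hall-outside-point R y₀ x₀∈X no-tight))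

hall : ∀ {R : Fin a → Fin b → Bool} {X} → HallCondition R X → SaturatingMatching R X
hall {X = X} = hall-bounded ∣ X ∣ ≤-refl

-- Independent sets and matchings

module _ (G : Graph) where

  private
    V = Fin (n G)
    variable
      u v : V
      S T X : Subset (n G)

  Adj-sym : Adj G u v → Adj G v u
  Adj-sym {u} {v} = trans (Graph.sym G v u)

  ∈-N⁺ : u ∈ S → Adj G u v → v ∈ N G S
  ∈-N⁺ = ∈-Nbr⁺ (adj G)

  ∈-N⁻ : ∀ S → v ∈ N G S → ∃ λ u → u ∈ S × Adj G u v
  ∈-N⁻ S = ∈-Nbr⁻ (adj G) S

  independent? : ∀ T → Dec (Independent G T)
  independent? T = all? λ u → all? λ v → (u ∈? T) →-dec ((v ∈? T) →-dec ¬? (adj G u v Bool.≟ true))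

  independent⇒∉N : Independent G T → v ∈ T → v ∉ N G T
  independent⇒∉N {T} T-independent v∈T v∈NT with ∈-N⁻ T v∈NT
  ... | u , u∈T , Auv = T-independent u _ u∈T v∈T Auv

  ∣T∣+∣NT∣≤n : Independent G T → ∣ T ∣ + ∣ N G T ∣ ≤ n G
  ∣T∣+∣NT∣≤n {T} T-independent =
    subst (_≤ n G) (∣p∪q∣≡∣p∣+∣q∣ T (N G T) (independent⇒∉N T-independent)) (∣p∣≤n (T ∪ N G T))

  weight : Subset (n G) → V → ℕ
  weight T v = χ (∁ T) v + χ (N G T) v

  weight-edge : Independent G T → Adj G u v → 2 ≤ weight T u + weight T v
  weight-edge {T} {u} {v} T-independent Auv with u ∈? T | v ∈? T
  ... | yes u∈T | yes v∈T = contradiction Auv (T-independent u v u∈T v∈T)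
  ... | yes u∈T | no  v∉T
    rewrite χ-∈ (x∉p⇒x∈∁p v∉T) | χ-∈ (∈-N⁺ u∈T Auv) = m≤n+m 2 (weight T u)
  ... | no  u∉T | yes v∈T
    rewrite χ-∈ (x∉p⇒x∈∁p u∉T) | χ-∈ (∈-N⁺ v∈T (Adj-sym Auv)) = m≤m+n 2 (weight T v)
  ... | no  u∉T | no  v∉T
    rewrite χ-∈ (x∉p⇒x∈∁p u∉T) | χ-∈ (x∉p⇒x∈∁p v∉T) = +-mono-≤ (s≤s z≤n) (s≤s z≤n)

  total-weight : Subset (n G) → List V → ℕ
  total-weight T L = count (∁ T) L + count (N G T) L

  total-weight-∷ : ∀ T v L → total-weight T (v ∷ L) ≡ weight T v + total-weight T L
  total-weight-∷ T v L rewrite count-∷ (∁ T) v L | count-∷ (N G T) v L =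
    +-interchange (χ (∁ T) v) (count (∁ T) L) (χ (N G T) v) (count (N G T) L)
    where
    +-interchange : ∀ a b c d → (a + b) + (c + d) ≡ (a + c) + (b + d)
    +-interchange = solve-∀

  2μ≤total-weight : Independent G T → ∀ M → Matching G M → 2 * length M ≤ total-weight T (endpoints G M)
  2μ≤total-weight T-independent [] _ = z≤n
  2μ≤total-weight {T} T-independent ((u , v) ∷ M) (Auv ∷ M-adjacent , _ ∷ _ ∷ M-unique) = begin
    2 * suc (length M)                                                ≡⟨ *-suc 2 (length M) ⟩
    2 + 2 * length M                                                  ≤⟨ +-mono-≤ (weight-edge T-independent Auv)
                                                                           (2μ≤total-weight T-independent M (M-adjacent , M-unique)) ⟩
    (weight T u + weight T v) + total-weight T E                      ≡⟨ +-assoc (weight T u) _ _ ⟩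
    weight T u + (weight T v + total-weight T E)                      ≡⟨ cong (weight T u +_) (total-weight-∷ T v E) ⟨
    weight T u + total-weight T (v ∷ E)                               ≡⟨ total-weight-∷ T u (v ∷ E) ⟨
    total-weight T (u ∷ v ∷ E)                                        ∎
    where
    open ≤-Reasoning
    E = endpoints G M

  matching-bound : Independent G T → ∀ {M} → Matching G M → ∣ T ∣ + 2 * length M ≤ n G + ∣ N G T ∣
  matching-bound {T} T-independent {M} (M-adjacent , E-unique) = begin
    ∣ T ∣ + 2 * length M                           ≤⟨ +-monoʳ-≤ ∣ T ∣ (2μ≤total-weight T-independent M (M-adjacent , E-unique)) ⟩
    ∣ T ∣ + (count (∁ T) E + count (N G T) E)      ≤⟨ +-monoʳ-≤ ∣ T ∣ (+-mono-≤ (count≤∣p∣ (∁ T) E-unique) (count≤∣p∣ (N G T) E-unique)) ⟩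
    ∣ T ∣ + (∣ ∁ T ∣ + ∣ N G T ∣)                  ≡⟨ +-assoc (∣ T ∣) (∣ ∁ T ∣) (∣ N G T ∣) ⟨
    ∣ T ∣ + ∣ ∁ T ∣ + ∣ N G T ∣                    ≡⟨ cong (_+ ∣ N G T ∣) (∣p∣+∣∁p∣≡n T) ⟩
    n G + ∣ N G T ∣                                ∎
    where
    open ≤-Reasoning
    E = endpoints G M

  ∣T∣+μ≤n : Independent G T → ∀ {M} → Matching G M → ∣ T ∣ + length M ≤ n G
  ∣T∣+μ≤n {T} T-independent {M} M-matching = *-cancelˡ-≤ 2 (+-cancelʳ-≤ ∣ N G T ∣ _ _ (begin
    2 * (∣ T ∣ + length M) + ∣ N G T ∣         ≡⟨ regroup (∣ T ∣) (length M) (∣ N G T ∣) ⟩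
    (∣ T ∣ + 2 * length M) + (∣ T ∣ + ∣ N G T ∣) ≤⟨ +-mono-≤ (matching-bound T-independent M-matching) (∣T∣+∣NT∣≤n T-independent) ⟩
    (n G + ∣ N G T ∣) + n G                    ≡⟨ double (n G) (∣ N G T ∣) ⟩
    2 * n G + ∣ N G T ∣                        ∎))
    where
    open ≤-Reasoning
    regroup : ∀ t m d → 2 * (t + m) + d ≡ (t + 2 * m) + (t + d)
    regroup = solve-∀
    double : ∀ k d → (k + d) + k ≡ 2 * k + d
    double = solve-∀

  independent-∪⁅⁆ : Independent G S → v ∉ N G S → Independent G (S ∪ ⁅ v ⁆)
  independent-∪⁅⁆ {S} {v} S-independent v∉NS u w u∈S∪v w∈S∪v Auw
    with x∈p∪q⁻ S ⁅ v ⁆ u∈S∪v | x∈p∪q⁻ S ⁅ v ⁆ w∈S∪v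
  ... | inj₁ u∈S | inj₁ w∈S = S-independent u w u∈S w∈S Auw
  ... | inj₁ u∈S | inj₂ w∈v rewrite x∈⁅y⁆⇒x≡y v w∈v = v∉NS (∈-N⁺ u∈S Auw)
  ... | inj₂ u∈v | inj₁ w∈S rewrite x∈⁅y⁆⇒x≡y v u∈v = v∉NS (∈-N⁺ w∈S (Adj-sym Auw))
  ... | inj₂ u∈v | inj₂ w∈v rewrite x∈⁅y⁆⇒x≡y v u∈v | x∈⁅y⁆⇒x≡y v w∈v =
    case trans (sym Auw) (Graph.irrefl G v) of λ ()

  maximum⇒∁⊆N : MaxIndependent G S → ∁ S ⊆ N G S
  maximum⇒∁⊆N {S} (S-independent , S-maximum) {v} v∈∁S with v ∈? N G S
  ... | yes v∈NS = v∈NS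
  ... | no  v∉NS = contradiction (S-maximum (S ∪ ⁅ v ⁆) (independent-∪⁅⁆ S-independent v∉NS)) (<⇒≱ (begin-strict
    ∣ S ∣                 <⟨ n<1+n ∣ S ∣ ⟩
    suc ∣ S ∣             ≡⟨ +-comm 1 ∣ S ∣ ⟩
    ∣ S ∣ + 1             ≡⟨ cong (∣ S ∣ +_) (∣⁅x⁆∣≡1 v) ⟨
    ∣ S ∣ + ∣ ⁅ v ⁆ ∣     ≡⟨ ∣p∪q∣≡∣p∣+∣q∣ S ⁅ v ⁆ disjoint ⟨
    ∣ S ∪ ⁅ v ⁆ ∣         ∎))
    where
    open ≤-Reasoning
    disjoint : ∀ {u} → u ∈ S → u ∉ ⁅ v ⁆
    disjoint u∈S u∈v rewrite x∈⁅y⁆⇒x≡y v u∈v = x∈∁p⇒x∉p v∈∁S u∈S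

  critical-inequality : Critical G S → Independent G T → ∣ T ∣ + ∣ N G S ∣ ≤ ∣ S ∣ + ∣ N G T ∣
  critical-inequality {S} {T} (_ , S-critical) T-independent =
    Equivalence.to (+m-+n≤+o-+p⇔m+p≤o+n (∣ T ∣) (∣ N G T ∣) (∣ S ∣) (∣ N G S ∣)) (S-critical T T-independent)

  -- Compare S with A = S ─ N(Z): N(A) and Z are disjoint parts of ∁S ⊆ N(S).
  maximum-critical⇒hall : MaxIndependent G S → Critical G S → HallCondition (adj G ∖ ∁ S) (∁ S)
  maximum-critical⇒hall {S} S-maximum@(S-independent , _) S-critical Z Z⊆∁S =
    +-cancelˡ-≤ (∣ A ∣ + ∣ N G A ∣) _ _ (begin
      (∣ A ∣ + ∣ N G A ∣) + ∣ Z ∣      ≡⟨ +-assoc (∣ A ∣) _ _ ⟩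
      ∣ A ∣ + (∣ N G A ∣ + ∣ Z ∣)      ≤⟨ +-monoʳ-≤ ∣ A ∣ ∣NA∣+∣Z∣≤∣NS∣ ⟩
      ∣ A ∣ + ∣ N G S ∣                ≤⟨ critical-inequality S-critical A-independent ⟩
      ∣ S ∣ + ∣ N G A ∣                ≤⟨ +-monoˡ-≤ ∣ N G A ∣ ∣S∣≤∣A∣+∣NZ∩S∣ ⟩
      (∣ A ∣ + ∣ NZ∩S ∣) + ∣ N G A ∣   ≡⟨ +-rearrange (∣ A ∣) _ _ ⟩
      (∣ A ∣ + ∣ N G A ∣) + ∣ NZ∩S ∣   ∎)
    where
    open ≤-Reasoning
    NZ∩S = Nbr (adj G ∖ ∁ S) Z
    A = S ─ N G Z

    A-independent : Independent G A
    A-independent u v u∈A v∈A = S-independent u v (p─q⊆p S _ u∈A) (p─q⊆p S _ v∈A)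

    S⊆A∪NZ∩S : S ⊆ A ∪ NZ∩S
    S⊆A∪NZ∩S {v} v∈S with v ∈? N G Z
    ... | no  v∉NZ = x∈p∪q⁺ (inj₁ (x∈p∧x∉q⇒x∈p─q v∈S v∉NZ))
    ... | yes v∈NZ with ∈-N⁻ Z v∈NZ
    ...   | z , z∈Z , Azv = x∈p∪q⁺ (inj₂ (∈-Nbr⁺ (adj G ∖ ∁ S) {y = v} z∈Z (∖-true⁺ (adj G) Azv (x∈p⇒x∉∁p v∈S))))

    ∣S∣≤∣A∣+∣NZ∩S∣ : ∣ S ∣ ≤ ∣ A ∣ + ∣ NZ∩S ∣
    ∣S∣≤∣A∣+∣NZ∩S∣ = ≤-trans (p⊆q⇒∣p∣≤∣q∣ S⊆A∪NZ∩S) (∣p∪q∣≤∣p∣+∣q∣ A NZ∩S)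

    NA∩Z≡∅ : ∀ {v} → v ∈ N G A → v ∉ Z
    NA∩Z≡∅ v∈NA v∈Z with ∈-N⁻ A v∈NA
    ... | a , a∈A , Aav = x∈p─q⇒x∉q a∈A (∈-N⁺ v∈Z (Adj-sym Aav))

    NA∪Z⊆∁S : N G A ∪ Z ⊆ ∁ S
    NA∪Z⊆∁S v∈NA∪Z with x∈p∪q⁻ (N G A) Z v∈NA∪Z
    ... | inj₂ v∈Z  = Z⊆∁S v∈Z
    ... | inj₁ v∈NA with ∈-N⁻ A v∈NA
    ...   | a , a∈A , Aav = x∉p⇒x∈∁p (λ v∈S → S-independent a _ (p─q⊆p S _ a∈A) v∈S Aav)

    ∣NA∣+∣Z∣≤∣NS∣ : ∣ N G A ∣ + ∣ Z ∣ ≤ ∣ N G S ∣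
    ∣NA∣+∣Z∣≤∣NS∣ = begin
      ∣ N G A ∣ + ∣ Z ∣   ≡⟨ ∣p∪q∣≡∣p∣+∣q∣ (N G A) Z NA∩Z≡∅ ⟨
      ∣ N G A ∪ Z ∣       ≤⟨ p⊆q⇒∣p∣≤∣q∣ (maximum⇒∁⊆N S-maximum ∘ NA∪Z⊆∁S) ⟩
      ∣ N G S ∣           ∎

    +-rearrange : ∀ a b c → (a + b) + c ≡ (a + c) + b
    +-rearrange = solve-∀

  edges : (V → V) → List V → List (V × V)
  edges f = List.map (λ v → v , f v)

  All-endpoints-edges : ∀ {P : V → Set} f {L} → All P L → All (P ∘ f) L → All P (endpoints G (edges f L))
  All-endpoints-edges f []           []             = []
  All-endpoints-edges f (Pv ∷ P-L) (Pfv ∷ Pf-L) = Pv ∷ Pfv ∷ All-endpoints-edges f P-L Pf-L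

  saturating⇒matching : SaturatingMatching (adj G ∖ X) X → ∃ λ M → Matching G M × length M ≡ ∣ X ∣
  saturating⇒matching {X} m =
    edges f L , edges-matching (filter⁺ (_∈? X) (allFin⁺ (n G))) (all-filter (_∈? X) (allFin (n G))) ,
    trans (length-map _ L) (length-filter-∈-allFin X)
    where
    L = filter (_∈? X) (allFin (n G))

    f : V → V
    f v with v ∈? X
    ... | yes v∈X = partner m v∈X
    ... | no  _   = v

    f-adjacent : v ∈ X → Adj G v (f v)
    f-adjacent {v} v∈X with v ∈? X
    ... | yes v∈X' = proj₁ (∖-true⁻ (adj G) {X} (related m v∈X'))
    ... | no  v∉X  = contradiction v∈X v∉X

    f-∉ : v ∈ X → f v ∉ X
    f-∉ {v} v∈X with v ∈? X
    ... | yes v∈X' = proj₂ (∖-true⁻ (adj G) {X} (related m v∈X'))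
    ... | no  v∉X  = contradiction v∈X v∉X

    f-injective : u ∈ X → v ∈ X → f u ≡ f v → u ≡ v
    f-injective {u} {v} u∈X v∈X with u ∈? X | v ∈? X
    ... | yes u∈X' | yes v∈X' = injective m u∈X' v∈X'
    ... | no  u∉X  | _        = contradiction u∈X u∉X
    ... | _        | no  v∉X  = contradiction v∈X v∉X

    ∈X⇒≢f : u ∈ X → v ∈ X → u ≢ f v
    ∈X⇒≢f u∈X v∈X u≡fv = f-∉ v∈X (subst (_∈ X) u≡fv u∈X)

    edges-matching : ∀ {L} → Unique L → All (_∈ X) L → Matching G (edges f L)
    edges-matching []                []             = [] , []
    edges-matching (v≢L ∷ L-unique) (v∈X ∷ L⊆X) with edges-matching L-unique L⊆X
    ... | L-adjacent , E-unique =
      f-adjacent v∈X ∷ L-adjacent ,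
      (∈X⇒≢f v∈X v∈X ∷ All-endpoints-edges f v≢L (All.map (∈X⇒≢f v∈X) L⊆X)) ∷
      All-endpoints-edges f (All.map (λ w∈X fv≡w → ∈X⇒≢f w∈X v∈X (sym fv≡w)) L⊆X)
                            (All.zipWith (λ (v≢w , w∈X) → v≢w ∘ f-injective v∈X w∈X) (v≢L , L⊆X)) ∷
      E-unique

  maximum-critical⇒KE : MaxIndependent G S → Critical G S → KönigEgerváry G
  maximum-critical⇒KE {S} S-maximum@(S-independent , _) S-critical =
    S , M , S-maximum , (M-matching , M-maximum) , ∣S∣+∣M∣≡n
    where
    M-saturating = saturating⇒matching (hall (maximum-critical⇒hall S-maximum S-critical))
    M = proj₁ M-saturating
    M-matching = proj₁ (proj₂ M-saturating)

    ∣S∣+∣M∣≡n : ∣ S ∣ + length M ≡ n G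
    ∣S∣+∣M∣≡n = trans (cong (∣ S ∣ +_) (proj₂ (proj₂ M-saturating))) (∣p∣+∣∁p∣≡n S)

    M-maximum : ∀ M' → Matching G M' → length M' ≤ length M
    M-maximum M' M'-matching =
      +-cancelˡ-≤ ∣ S ∣ _ _ (≤-trans (∣T∣+μ≤n S-independent M'-matching) (≤-reflexive (sym ∣S∣+∣M∣≡n)))

  KE⇒maximum-critical : KönigEgerváry G → MaxIndependent G S → Critical G S
  KE⇒maximum-critical {S} (S₀ , M , (S₀-independent , S₀-maximum) , (M-matching , _) , ∣S₀∣+μ≡n)
                          (S-independent , S-maximum) =
    S-independent , λ T T-independent →
      Equivalence.from (+m-+n≤+o-+p⇔m+p≤o+n (∣ T ∣) (∣ N G T ∣) (∣ S ∣) (∣ N G S ∣))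
        (+-cancelʳ-≤ (∣ S ∣ + 2 * μ) _ _ (begin
          (∣ T ∣ + ∣ N G S ∣) + (∣ S ∣ + 2 * μ)   ≡⟨ swap (∣ T ∣) (∣ N G S ∣) (∣ S ∣) (2 * μ) ⟩
          (∣ T ∣ + 2 * μ) + (∣ S ∣ + ∣ N G S ∣)   ≤⟨ +-mono-≤ (matching-bound T-independent M-matching) (∣T∣+∣NT∣≤n S-independent) ⟩
          (n G + ∣ N G T ∣) + n G                 ≡⟨ cong₂ (λ a b → (a + ∣ N G T ∣) + b) ∣S∣+μ≡n ∣S∣+μ≡n ⟨
          (∣ S ∣ + μ + ∣ N G T ∣) + (∣ S ∣ + μ)   ≡⟨ regroup (∣ S ∣) μ (∣ N G T ∣) ⟩
          (∣ S ∣ + ∣ N G T ∣) + (∣ S ∣ + 2 * μ)   ∎))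
    where
    open ≤-Reasoning
    μ = length M

    ∣S∣+μ≡n : ∣ S ∣ + μ ≡ n G
    ∣S∣+μ≡n = trans (cong (_+ μ) (≤-antisym (S₀-maximum S S-independent) (S-maximum S₀ S₀-independent))) ∣S₀∣+μ≡n

    swap : ∀ t d s k → (t + d) + (s + k) ≡ (t + k) + (s + d)
    swap = solve-∀
    regroup : ∀ s m d → (s + m + d) + (s + m) ≡ (s + d) + (s + 2 * m)
    regroup = solve-∀

theorem6 : (G : Graph) →
    (KönigEgerváry G ⇔ (∃ λ (S : Subset (n G)) → MaxIndependent G S × Critical G S))
    × (KönigEgerváry G ⇔ (∀ (S : Subset (n G)) → MaxIndependent G S → Critical G S))
theorem6 G =
  mk⇔ (λ KE → let (S , _ , S-maximum , _) = KE in S , S-maximum , KE⇒maximum-critical G KE S-maximum)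
      (λ (S , S-maximum , S-critical) → maximum-critical⇒KE G S-maximum S-critical) ,
  mk⇔ (λ KE S → KE⇒maximum-critical G KE)
      (λ all-critical → let (S , S-maximum) = maximum-exists (independent? G) ∅-independent
                        in maximum-critical⇒KE G S-maximum (all-critical S S-maximum))
  where
  ∅-independent : Independent G ⊥
  ∅-independent u _ u∈⊥ _ _ = ∉⊥ u∈⊥
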